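{- Let $\mathcal{H}\in Forb(n,T_5,\eta,\mu)$, let $(X,Y)$ be an optimal ordered partition of $\mathcal{H}$, and let $\alpha\ge 200\mu$. Then: (i) the number of distinct poor vertices of the $\alpha$-rich edges of $\mathcal{H}$ is at most $2\mu n$; (ii) for every vertex $x\in X$, the number of $\alpha$-rich edges containing $x$ is at most $2\mu n^2$.
   Context: A 3-graph on $[n]$ is a set of 3-subsets of $[n]$; $T_5=\{123,124,125,345\}$. Standing assumption: $\mu,\eta$ are small positive constants with $\mu\gg\eta$, in particular $\mu^3\ge1000H(\eta)$ where $H$ is the binary entropy function. For an ordered partition $(X,Y)$ of the vertex set, an edge is consistent if it has exactly two vertices in $X$, inconsistent otherwise; a partition is optimal if it minimizes the number of inconsistent edges, and $D_{\mathcal{H}}$ is that minimum. $Forb(n,T_5,\eta)$ is the set of $T_5$-free 3-graphs on $[n]$ with $D_{\mathcal{H}}\le\eta n^3$. An ordered partition $(X,Y)$ of $\mathcal{H}$ is $\mu$-lower-dense if: (i) for every matching $G_1\subset\binom{X}{2}$ and every graph $G_2\subset X\times Y$ with $|G_1|>\mu n$, $|G_2|>\mu n^2$, the number of pairs $(ab,uv)$ with $ab\in G_2$, $uv\in G_1$, $abu,abv\in\mathcal{H}$ exceeds $|G_1||G_2|/72$; (ii) for every graph $G_1\subset\binom{X}{2}$ and every matching $G_2\subset\binom{Y}{2}$ with $|G_1|>\mu n^2$, $|G_2|>\mu n$, the number of pairs $(ab,uv)$ with $ab\in G_2$, $uv\in G_1$, $auv,buv\in\mathcal{H}$ exceeds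 $|G_1||G_2|/8$; (iii) for every $A_X\subset X$, $A_Y\subset Y$ with $|A_X|,|A_Y|\ge\mu n$, the number of edges $E$ with $|E\cap A_X|=2$, $|E\cap A_Y|=1$ exceeds $|A_X|^2|A_Y|/8$; (iv) for every $Y'\subset Y$ with $|Y'|\ge 2\mu n$ and sets $X_y\subset X$ ($y\in Y'$) with $|X_y|>200\mu n$, the number of edges $E$ for which some $y\in Y'$ has $y\in E$ and $|E\cap X_y|=2$ exceeds $10000\mu^3n^3$; (v) $||Y|-n/3|<\mu n$. $Forb(n,T_5,\eta,\mu)$ is the set of $\mathcal{H}\in Forb(n,T_5,\eta)$ all of whose optimal partitions are $\mu$-lower-dense. For a 2-set $S$ and $A\subset[n]$, $L_A(S)=\{v\in A: S\cup\{v\}\in\mathcal{H}\}$. An edge $xyz\in\mathcal{H}$ is $\alpha$-rich with respect to $(X,Y)$ if $x\in X$, $y,z\in Y$ and $\max\{|L_X(\{x,y\})|,|L_X(\{x,z\})|\}>\alpha n$. For such an edge, $z$ is its poor vertex if $|L_X(\{x,y\})|\ge|L_X(\{x,z\})|$ (ties decided arbitrarily, so each rich edge has one poor vertex).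
   Formalization: The constants μ, η and α are taken to be rational. -}

module Defs where

open import Data.Bool using (Bool; true; false; T; _∧_; _∨_; not)
open import Data.Nat as ℕ using (ℕ; zero; suc; _⊓_; _⊔_; _≡ᵇ_; _^_; _∸_)
open import Data.Integer as ℤ using (+_)
open import Data.Rational as ℚ using (ℚ; _/_; _*_; _-_; _<_; _≤_; ↥_; ↧ₙ_)
open import Data.Fin using (Fin)
open import Data.Fin.Subset as Sub using (Subset; ∣_∣; ⁅_⁆; _∪_; _∩_; ∁; _∈_; _⊆_; Empty)
open import Data.Vec using (Vec; []; _∷_; lookup; tabulate)
open import Data.List using (List; []; _∷_; map; _++_; length; filterᵇ; foldr; allFin)
open import Data.Nat.ListAction using (sum)
open import Data.Bool.ListAction using (all; any)
open import Data.Product using (Σ; ∃; _×_; _,_)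
open import Relation.Binary.PropositionalEquality using (_≡_; _≢_)
open import Relation.Nullary using (¬_)

private
  variable
    n : ℕ

allSubsets : (n : ℕ) → List (Subset n)
allSubsets zero    = [] ∷ []
allSubsets (suc n) = map (true ∷_) (allSubsets n) ++ map (false ∷_) (allSubsets n)

count : (Subset n → Bool) → ℕ
count {n} p = length (filterᵇ p (allSubsets n))

count₂ : (Subset n → Subset n → Bool) → ℕ
count₂ {n} p = sum (map (λ S → count (p S)) (allSubsets n))

allIn : Subset n → (Fin n → Bool) → Bool
allIn {n} T q = all (λ w → not (lookup T w) ∨ q w) (allFin n)

⟦_⟧ : ℕ → ℚ
⟦ k ⟧ = (+ k) / 1

pair : Fin n → Fin n → Subset n
pair x y = ⁅ x ⁆ ∪ ⁅ y ⁆

triple : Fin n → Fin n → Fin n → Subset n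
triple x y z = ⁅ x ⁆ ∪ ⁅ y ⁆ ∪ ⁅ z ⁆

-- A 3-graph on [n]: its edges are exactly the 3-subsets S with H S = true
-- (values on subsets of other sizes are irrelevant).
ThreeGraph : ℕ → Set
ThreeGraph n = Subset n → Bool

isEdge : ThreeGraph n → Subset n → Bool
isEdge H S = H S ∧ (∣ S ∣ ≡ᵇ 3)

Edge : ThreeGraph n → Subset n → Set
Edge H S = T (isEdge H S)

-- A (2-)graph on [n]: its edges are exactly the 2-subsets S with G S = true.
Graph : ℕ → Set
Graph n = Subset n → Bool

isEdge₂ : Graph n → Subset n → Bool
isEdge₂ G S = G S ∧ (∣ S ∣ ≡ᵇ 2)

Edge₂ : Graph n → Subset n → Set
Edge₂ G S = T (isEdge₂ G S)

size₂ : Graph n → ℕ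
size₂ G = count (isEdge₂ G)

Matching : Graph n → Set
Matching G = ∀ S T → Edge₂ G S → Edge₂ G T → S ≢ T → Empty (S ∩ T)

T5-free : ThreeGraph n → Set
T5-free H = ∀ a b c d e →
  a ≢ b → a ≢ c → a ≢ d → a ≢ e → b ≢ c → b ≢ d → b ≢ e → c ≢ d → c ≢ e → d ≢ e →
  ¬ (Edge H (triple a b c) × Edge H (triple a b d) × Edge H (triple a b e) × Edge H (triple c d e))

-- Ordered partitions (X , Y) are given by X; Y = ∁ X.

incons : ThreeGraph n → Subset n → ℕ
incons H X = count (λ S → isEdge H S ∧ not (∣ S ∩ X ∣ ≡ᵇ 2))

Optimal : ThreeGraph n → Subset n → Set
Optimal {n} H X = ∀ (X' : Subset n) → incons H X ℕ.≤ incons H X'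

D : ThreeGraph n → ℕ
D {n} H = foldr (λ X m → incons H X ⊓ m) (incons H Sub.⊥) (allSubsets n)

pairsI : ThreeGraph n → Graph n → Graph n → ℕ
pairsI H G₁ G₂ = count₂ (λ ab uv → isEdge₂ G₂ ab ∧ isEdge₂ G₁ uv ∧ allIn uv (λ w → isEdge H (ab ∪ ⁅ w ⁆)))

pairsII : ThreeGraph n → Graph n → Graph n → ℕ
pairsII H G₁ G₂ = count₂ (λ ab uv → isEdge₂ G₂ ab ∧ isEdge₂ G₁ uv ∧ allIn ab (λ w → isEdge H (uv ∪ ⁅ w ⁆)))

LowerDense : ℚ → (n : ℕ) → ThreeGraph n → Subset n → Set
LowerDense μ n H X =
  (∀ (G₁ G₂ : Graph n) → Matching G₁ → (∀ S → Edge₂ G₁ S → S ⊆ X)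
     → (∀ S → Edge₂ G₂ S → ∣ S ∩ X ∣ ≡ 1 × ∣ S ∩ ∁ X ∣ ≡ 1)
     → μ * ⟦ n ⟧ < ⟦ size₂ G₁ ⟧ → μ * ⟦ n ^ 2 ⟧ < ⟦ size₂ G₂ ⟧
     → size₂ G₁ ℕ.* size₂ G₂ ℕ.< 72 ℕ.* pairsI H G₁ G₂)
  ×
  (∀ (G₁ G₂ : Graph n) → (∀ S → Edge₂ G₁ S → S ⊆ X)
     → Matching G₂ → (∀ S → Edge₂ G₂ S → S ⊆ ∁ X)
     → μ * ⟦ n ^ 2 ⟧ < ⟦ size₂ G₁ ⟧ → μ * ⟦ n ⟧ < ⟦ size₂ G₂ ⟧
     → size₂ G₁ ℕ.* size₂ G₂ ℕ.< 8 ℕ.* pairsII H G₁ G₂)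
  ×
  (∀ (AX AY : Subset n) → AX ⊆ X → AY ⊆ ∁ X
     → μ * ⟦ n ⟧ ≤ ⟦ ∣ AX ∣ ⟧ → μ * ⟦ n ⟧ ≤ ⟦ ∣ AY ∣ ⟧
     → ∣ AX ∣ ^ 2 ℕ.* ∣ AY ∣ ℕ.< 8 ℕ.* count (λ E → isEdge H E ∧ (∣ E ∩ AX ∣ ≡ᵇ 2) ∧ (∣ E ∩ AY ∣ ≡ᵇ 1)))
  ×
  (∀ (Y' : Subset n) (Xs : Fin n → Subset n) → Y' ⊆ ∁ X
     → ⟦ 2 ⟧ * μ * ⟦ n ⟧ ≤ ⟦ ∣ Y' ∣ ⟧
     → (∀ y → y ∈ Y' → Xs y ⊆ X × ⟦ 200 ⟧ * μ * ⟦ n ⟧ < ⟦ ∣ Xs y ∣ ⟧)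
     → ⟦ 10000 ⟧ * (μ * μ * μ) * ⟦ n ^ 3 ⟧
         < ⟦ count (λ E → isEdge H E ∧ any (λ y → lookup Y' y ∧ lookup E y ∧ (∣ E ∩ Xs y ∣ ≡ᵇ 2)) (allFin n)) ⟧)
  ×
  (ℚ.∣ ⟦ ∣ ∁ X ∣ ⟧ - (+ n) / 3 ∣ < μ * ⟦ n ⟧)

InForb : (n : ℕ) → ℚ → ThreeGraph n → Set
InForb n η H = T5-free H × ⟦ D H ⟧ ≤ η * ⟦ n ^ 3 ⟧

InForbμ : (n : ℕ) → ℚ → ℚ → ThreeGraph n → Set
InForbμ n η μ H = InForb n η H × (∀ X → Optimal H X → LowerDense μ n H X)

-- Standing assumption μ³ ≥ 1000·H(η), H binary entropy (log base 2),
-- for rational 0 < η < 1 and μ > 0. Writing η = p/q, μ = a/b, r = a³, s = b³,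
--   r/s ≥ 1000[(p/q)log₂(q/p) + ((q-p)/q)log₂(q/(q-p))]
--   ⇔ 2^(r q) · p^(1000 s p) · (q-p)^(1000 s (q-p)) ≥ q^(1000 s q)     (exact).
EntropyCond : ℚ → ℚ → Set
EntropyCond μ η =
  let p = ℤ.∣ ↥ η ∣ ; q = ↧ₙ η ; a = ℤ.∣ ↥ μ ∣ ; b = ↧ₙ μ
      r = a ^ 3 ; s = b ^ 3
  in q ^ (1000 ℕ.* s ℕ.* q)
       ℕ.≤ 2 ^ (r ℕ.* q) ℕ.* p ^ (1000 ℕ.* s ℕ.* p) ℕ.* (q ∸ p) ^ (1000 ℕ.* s ℕ.* (q ∸ p))

L : ThreeGraph n → Subset n → Subset n → Subset n
L H A S = tabulate (λ v → lookup A v ∧ isEdge H (S ∪ ⁅ v ⁆))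

Rich : ℚ → (n : ℕ) → ThreeGraph n → Subset n → Subset n → Set
Rich α n H X E = Σ (Fin n) λ x → Σ (Fin n) λ y → Σ (Fin n) λ z →
  E ≡ triple x y z × Edge H E × x ∈ X × y ∈ ∁ X × z ∈ ∁ X ×
  α * ⟦ n ⟧ < ⟦ ∣ L H X (pair x y) ∣ ⊔ ∣ L H X (pair x z) ∣ ⟧

IsPoor : (n : ℕ) → ThreeGraph n → Subset n → Subset n → Fin n → Set
IsPoor n H X E z = Σ (Fin n) λ x → Σ (Fin n) λ y →
  y ≢ z × E ≡ triple x y z × x ∈ X × y ∈ ∁ X × z ∈ ∁ X ×
  ∣ L H X (pair x z) ∣ ℕ.≤ ∣ L H X (pair x y) ∣

-- a choice of poor vertex for each α-rich edge (ties decided arbitrarily)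
PoorChoice : ℚ → (n : ℕ) → ThreeGraph n → Subset n → (Subset n → Fin n) → Set
PoorChoice α n H X c = ∀ E → Rich α n H X E → IsPoor n H X E (c E)

-- If v is the poor vertex of an α-rich edge xwv, with |L_X(xw)| > αn ≥ 200μn, then no edge
-- through v meets L_X(xw) in two vertices a, b: otherwise xwa, xwb, xwv, abv would be a copy
-- of T₅. So a set Y' of such poor vertices, with the sets X_v = L_X(xw), produces no edge of
-- the kind counted by lower-density condition (iv), which forces |Y'| < 2μn.
-- For (ii), every α-rich edge through x ∈ X is xwv with v a poor vertex, and the poor vertices
-- arising this way again number fewer than 2μn, while each has at most n partners w.
module Submission where

open import Defs
open import Data.Bool using (Bool; T; _∧_)
open import Data.Bool.Properties using (T-≡; T-∧)
open import Data.Bool.ListAction using (any)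
open import Data.Empty using (⊥; ⊥-elim)
open import Data.Fin using (Fin; zero; suc)
open import Data.Fin.Properties using (any?; suc-injective)
open import Data.Fin.Subset
  using (Subset; inside; outside; ∣_∣; ⁅_⁆; _∪_; _∩_; ∁; _∈_; _∉_; _⊆_; Nonempty)
open import Data.Fin.Subset.Properties
  using ( _∈?_; ∣⁅x⁆∣≡1; x∈⁅x⁆; x∈⁅y⁆⇒x≡y; x∈p∪q⁺; x∈p∪q⁻; q⊆p∪q; p∩q⊆p; p∩q⊆q
        ; x∈∁p⇒x∉p; x∉p⇒x∈∁p; p⊂q⇒∣p∣<∣q∣; ⊆-antisym
        ; ∪-assoc; ∪-comm; ∪-idem; ∣p∣≤∣x∷p∣)
open import Data.Integer as ℤ using (+_)
import Data.Integer.Properties as ℤ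
open import Data.List
  using (List; []; _∷_; map; length; _++_; allFin; cartesianProductWith)
open import Data.List.Properties using (length-++; length-map; length-tabulate)
open import Data.List.Membership.Propositional using () renaming (_∈_ to _∈ₗ_)
open import Data.List.Membership.Propositional.Properties
  using (∈-∃++; ∈-++⁻; ∈-++⁺ˡ; ∈-++⁺ʳ; ∈-map⁺; ∈-map⁻; ∈-filter⁻; ∈-allFin; ∈-cartesianProductWith⁺)
open import Data.List.Relation.Binary.Disjoint.Propositional using (Disjoint)
open import Data.List.Relation.Binary.Subset.Propositional using () renaming (_⊆_ to _⊆ₗ_)
import Data.List.Relation.Unary.All as All
open import Data.List.Relation.Unary.AllPairs using ([]; _∷_)
open import Data.List.Relation.Unary.Any using (here; there; satisfied)
open import Data.List.Relation.Unary.Any.Properties using (any⁻)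
open import Data.List.Relation.Unary.Unique.Propositional using (Unique)
open import Data.List.Relation.Unary.Unique.Propositional.Properties using (map⁺; ++⁺; filter⁺)
open import Data.Nat as ℕ using (ℕ; zero; suc; _+_; _^_; _⊔_; z≤n; s≤s)
open import Data.Nat.Properties as ℕ
  using (≡ᵇ⇒≡; ≤-refl; ≤-reflexive; ≤-trans; +-suc; +-monoʳ-≤; ≤⇒≯; ⊔-lub; <⇒≤; ≰⇒>)
import Data.Nat.Coprimality as Coprime
open import Data.Product using (∃; ∃₂; _×_; _,_; proj₁; proj₂)
open import Data.Rational as ℚ using (ℚ; mkℚ; _*_; _<_; _≤_; 0ℚ; 1ℚ; NonNegative; *≤*)
import Data.Rational.Properties as ℚ
open import Data.Sum using (_⊎_; inj₁; inj₂)
open import Data.Vec using ([]; _∷_; here; there; lookup; tabulate)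
open import Data.Vec.Properties using (lookup∘tabulate; []=⇒lookup; lookup⇒[]=; ∷-injectiveʳ)
open import Function using (_∘_; Equivalence)
open import Relation.Binary.PropositionalEquality
open import Relation.Nullary using (Dec; yes; no; contradiction; ¬?)
open import Relation.Nullary.Decidable using (⌊_⌋; toWitness; fromWitness; _×-dec_; T?)
open import Relation.Unary using (Pred; Decidable)

private
  variable
    n : ℕ
    a b c i x : Fin n
    p q E X : Subset n

open Equivalence using (to; from)

-- Subsets of Fin n

T-lookup⇒∈ : T (lookup p x) → x ∈ p
T-lookup⇒∈ {p = p} {x} t = lookup⇒[]= x p (to T-≡ t)

∈-tabulate⁻ : ∀ {f : Fin n → Bool} → x ∈ tabulate f → T (f x)
∈-tabulate⁻ {x = x} {f} x∈ = from T-≡ (trans (sym (lookup∘tabulate f x)) ([]=⇒lookup x∈))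

∈-tabulate⁺ : ∀ {f : Fin n → Bool} → T (f x) → x ∈ tabulate f
∈-tabulate⁺ {x = x} {f} t = lookup⇒[]= x (tabulate f) (trans (lookup∘tabulate f x) (to T-≡ t))

subsetOf : ∀ {ℓ} {P : Pred (Fin n) ℓ} → Decidable P → Subset n
subsetOf P? = tabulate (λ i → ⌊ P? i ⌋)

module _ {ℓ} {P : Pred (Fin n) ℓ} {P? : Decidable P} where

  ∈-subsetOf⁻ : x ∈ subsetOf P? → P x
  ∈-subsetOf⁻ = toWitness ∘ ∈-tabulate⁻

  ∈-subsetOf⁺ : P x → x ∈ subsetOf P?
  ∈-subsetOf⁺ = ∈-tabulate⁺ ∘ fromWitness

∈∧∉⇒≢ : a ∈ p → b ∉ p → a ≢ b
∈∧∉⇒≢ a∈p b∉p refl = b∉p a∈p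

nonempty : ∀ (p : Subset n) → 0 ℕ.< ∣ p ∣ → Nonempty p
nonempty (inside ∷ p) _ = zero , here
nonempty (outside ∷ p) 0<∣p∣ with x , x∈p ← nonempty p 0<∣p∣ = suc x , there x∈p

two-elements : ∀ (p : Subset n) → 1 ℕ.< ∣ p ∣ → ∃₂ λ a b → a ≢ b × a ∈ p × b ∈ p
two-elements (inside ∷ p) (s≤s 0<∣p∣) with b , b∈p ← nonempty p 0<∣p∣ =
  zero , suc b , (λ ()) , here , there b∈p
two-elements (outside ∷ p) 1<∣p∣ with a , b , a≢b , a∈p , b∈p ← two-elements p 1<∣p∣ =
  suc a , suc b , a≢b ∘ suc-injective , there a∈p , there b∈p

∣p∪q∣≤∣p∣+∣q∣ : ∀ (p q : Subset n) → ∣ p ∪ q ∣ ℕ.≤ ∣ p ∣ + ∣ q ∣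
∣p∪q∣≤∣p∣+∣q∣ [] [] = z≤n
∣p∪q∣≤∣p∣+∣q∣ (inside ∷ p) (b ∷ q) = s≤s (≤-trans (∣p∪q∣≤∣p∣+∣q∣ p q) (+-monoʳ-≤ ∣ p ∣ (∣p∣≤∣x∷p∣ b q)))
∣p∪q∣≤∣p∣+∣q∣ (outside ∷ p) (inside ∷ q) = ≤-trans (s≤s (∣p∪q∣≤∣p∣+∣q∣ p q)) (≤-reflexive (sym (+-suc ∣ p ∣ ∣ q ∣)))
∣p∪q∣≤∣p∣+∣q∣ (outside ∷ p) (outside ∷ q) = ∣p∪q∣≤∣p∣+∣q∣ p q

p⊆q∧∣q∣≤∣p∣⇒p≡q : p ⊆ q → ∣ q ∣ ℕ.≤ ∣ p ∣ → p ≡ q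
p⊆q∧∣q∣≤∣p∣⇒p≡q {p = p} {q} p⊆q ∣q∣≤∣p∣ = ⊆-antisym p⊆q q⊆p
  where
  q⊆p : q ⊆ p
  q⊆p {x} x∈q with x ∈? p
  ... | yes x∈p = x∈p
  ... | no x∉p = contradiction (p⊂q⇒∣p∣<∣q∣ (p⊆q , x , x∈q , x∉p)) (≤⇒≯ ∣q∣≤∣p∣)

x∉p⇒∣p∣<∣⁅x⁆∪p∣ : x ∉ p → ∣ p ∣ ℕ.< ∣ ⁅ x ⁆ ∪ p ∣
x∉p⇒∣p∣<∣⁅x⁆∪p∣ {x = x} {p} x∉p = p⊂q⇒∣p∣<∣q∣ (q⊆p∪q ⁅ x ⁆ p , x , x∈p∪q⁺ (inj₁ (x∈⁅x⁆ x)) , x∉p)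

-- Triples

∈-triple⁻ : i ∈ triple a b c → i ≡ a ⊎ i ≡ b ⊎ i ≡ c
∈-triple⁻ {a = a} {b} {c} i∈ with x∈p∪q⁻ ⁅ a ⁆ (⁅ b ⁆ ∪ ⁅ c ⁆) i∈
... | inj₁ i∈a = inj₁ (x∈⁅y⁆⇒x≡y a i∈a)
... | inj₂ i∈bc with x∈p∪q⁻ ⁅ b ⁆ ⁅ c ⁆ i∈bc
...   | inj₁ i∈b = inj₂ (inj₁ (x∈⁅y⁆⇒x≡y b i∈b))
...   | inj₂ i∈c = inj₂ (inj₂ (x∈⁅y⁆⇒x≡y c i∈c))

∈-triple⁺ : i ≡ a ⊎ i ≡ b ⊎ i ≡ c → i ∈ triple a b c
∈-triple⁺ {i = i} (inj₁ refl) = x∈p∪q⁺ (inj₁ (x∈⁅x⁆ i))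
∈-triple⁺ {i = i} (inj₂ (inj₁ refl)) = x∈p∪q⁺ (inj₂ (x∈p∪q⁺ (inj₁ (x∈⁅x⁆ i))))
∈-triple⁺ {i = i} (inj₂ (inj₂ refl)) = x∈p∪q⁺ (inj₂ (x∈p∪q⁺ (inj₂ (x∈⁅x⁆ i))))

∣pair∣≤2 : ∀ (a b : Fin n) → ∣ pair a b ∣ ℕ.≤ 2
∣pair∣≤2 a b = ≤-trans (∣p∪q∣≤∣p∣+∣q∣ ⁅ a ⁆ ⁅ b ⁆) (≤-reflexive (cong₂ _+_ (∣⁅x⁆∣≡1 a) (∣⁅x⁆∣≡1 b)))

triple-aab : ∀ (a b : Fin n) → triple a a b ≡ pair a b
triple-aab a b = trans (sym (∪-assoc ⁅ a ⁆ ⁅ a ⁆ ⁅ b ⁆)) (cong (_∪ ⁅ b ⁆) (∪-idem ⁅ a ⁆))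

triple-distinct : ∣ triple a b c ∣ ≡ 3 → a ≢ b × a ≢ c × b ≢ c
triple-distinct {a = a} {b} {c} ∣abc∣≡3 = a≢b , a≢c , b≢c
  where
  not-a-pair : ∀ {u v} → triple a b c ≡ pair u v → ⊥
  not-a-pair {u} {v} abc≡uv with subst (ℕ._≤ 2) (trans (cong ∣_∣ (sym abc≡uv)) ∣abc∣≡3) (∣pair∣≤2 u v)
  ... | s≤s (s≤s ())
  a≢b : a ≢ b
  a≢b refl = not-a-pair (triple-aab a c)
  a≢c : a ≢ c
  a≢c refl = not-a-pair (trans (cong (⁅ a ⁆ ∪_) (∪-comm ⁅ b ⁆ ⁅ a ⁆)) (triple-aab a b))
  b≢c : b ≢ c
  b≢c refl = not-a-pair (cong (⁅ a ⁆ ∪_) (∪-idem ⁅ b ⁆))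

∣triple∣≥3 : a ≢ b → a ≢ c → b ≢ c → 3 ℕ.≤ ∣ triple a b c ∣
∣triple∣≥3 {a = a} {b} {c} a≢b a≢c b≢c =
  ≤-trans (s≤s ∣bc∣≥2) (x∉p⇒∣p∣<∣⁅x⁆∪p∣ a∉bc)
  where
  ∣bc∣≥2 : 2 ℕ.≤ ∣ ⁅ b ⁆ ∪ ⁅ c ⁆ ∣
  ∣bc∣≥2 = subst (λ k → suc k ℕ.≤ ∣ ⁅ b ⁆ ∪ ⁅ c ⁆ ∣) (∣⁅x⁆∣≡1 c)
                 (x∉p⇒∣p∣<∣⁅x⁆∪p∣ (b≢c ∘ x∈⁅y⁆⇒x≡y c))
  a∉bc : a ∉ ⁅ b ⁆ ∪ ⁅ c ⁆
  a∉bc a∈bc with x∈p∪q⁻ ⁅ b ⁆ ⁅ c ⁆ a∈bc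
  ... | inj₁ a∈b = a≢b (x∈⁅y⁆⇒x≡y b a∈b)
  ... | inj₂ a∈c = a≢c (x∈⁅y⁆⇒x≡y c a∈c)

triple-unique : ∣ E ∣ ≡ 3 → a ≢ b → a ≢ c → b ≢ c → a ∈ E → b ∈ E → c ∈ E → triple a b c ≡ E
triple-unique {E = E} {a} {b} {c} ∣E∣≡3 a≢b a≢c b≢c a∈E b∈E c∈E =
  p⊆q∧∣q∣≤∣p∣⇒p≡q abc⊆E (subst (ℕ._≤ _) (sym ∣E∣≡3) (∣triple∣≥3 a≢b a≢c b≢c))
  where
  abc⊆E : triple a b c ⊆ E
  abc⊆E i∈ with ∈-triple⁻ i∈
  ... | inj₁ refl = a∈E
  ... | inj₂ (inj₁ refl) = b∈E
  ... | inj₂ (inj₂ refl) = c∈E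

inside-vertex-of-triple : i ∈ X → i ∈ triple a b c → b ∉ X → c ∉ X → i ≡ a
inside-vertex-of-triple i∈X i∈ b∉X c∉X with ∈-triple⁻ i∈
... | inj₁ i≡a = i≡a
... | inj₂ (inj₁ refl) = contradiction i∈X b∉X
... | inj₂ (inj₂ refl) = contradiction i∈X c∉X

outside-vertex-of-triple : a ∈ X → i ∈ triple a b c → i ∉ X → i ≡ b ⊎ i ≡ c
outside-vertex-of-triple a∈X i∈ i∉X with ∈-triple⁻ i∈
... | inj₁ refl = contradiction a∈X i∉X
... | inj₂ i≡b⊎i≡c = i≡b⊎i≡c

-- Counting subsets

Unique⇒length-mono-⊆ : ∀ {A : Set} {xs ys : List A} → Unique xs → xs ⊆ₗ ys → length xs ℕ.≤ length ys
Unique⇒length-mono-⊆ [] _ = z≤n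
Unique⇒length-mono-⊆ {xs = x ∷ xs} (x≢xs ∷ xs!) xs⊆ys
  with ys₁ , ys₂ , refl ← ∈-∃++ (xs⊆ys (here refl)) = begin
    suc (length xs)                 ≤⟨ s≤s (Unique⇒length-mono-⊆ xs! xs⊆ys₁ys₂) ⟩
    suc (length (ys₁ ++ ys₂))       ≡⟨ cong suc (length-++ ys₁) ⟩
    suc (length ys₁ + length ys₂)   ≡⟨ sym (+-suc (length ys₁) (length ys₂)) ⟩
    length ys₁ + suc (length ys₂)   ≡⟨ sym (length-++ ys₁) ⟩
    length (ys₁ ++ x ∷ ys₂)         ∎
  where
  open ℕ.≤-Reasoning
  xs⊆ys₁ys₂ : xs ⊆ₗ ys₁ ++ ys₂
  xs⊆ys₁ys₂ z∈xs with ∈-++⁻ ys₁ (xs⊆ys (there z∈xs))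
  ... | inj₁ z∈ys₁ = ∈-++⁺ˡ z∈ys₁
  ... | inj₂ (here refl) = contradiction refl (All.lookup x≢xs z∈xs)
  ... | inj₂ (there z∈ys₂) = ∈-++⁺ʳ ys₁ z∈ys₂

allSubsets-unique : ∀ n → Unique (allSubsets n)
allSubsets-unique zero = All.[] ∷ []
allSubsets-unique (suc n) = ++⁺ (map⁺ ∷-injectiveʳ unique) (map⁺ ∷-injectiveʳ unique) disjoint
  where
  unique = allSubsets-unique n
  disjoint : Disjoint (map (inside ∷_) (allSubsets n)) (map (outside ∷_) (allSubsets n))
  disjoint (p∈ , q∈) with ∈-map⁻ (inside ∷_) p∈ | ∈-map⁻ (outside ∷_) q∈
  ... | _ , _ , refl | _ , _ , ()

count≤length : ∀ (P : Subset n → Bool) (ys : List (Subset n)) →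
  (∀ S → T (P S) → S ∈ₗ ys) → count P ℕ.≤ length ys
count≤length {n} P ys covered =
  Unique⇒length-mono-⊆ (filter⁺ (T? ∘ P) (allSubsets-unique n))
                       (λ S∈ → covered _ (proj₂ (∈-filter⁻ (T? ∘ P) {xs = allSubsets n} S∈)))

elements : Subset n → List (Fin n)
elements [] = []
elements (inside ∷ p) = zero ∷ map suc (elements p)
elements (outside ∷ p) = map suc (elements p)

length-elements : ∀ (p : Subset n) → length (elements p) ≡ ∣ p ∣
length-elements [] = refl
length-elements (inside ∷ p) = cong suc (trans (length-map suc (elements p)) (length-elements p))
length-elements (outside ∷ p) = trans (length-map suc (elements p)) (length-elements p)

∈-elements : x ∈ p → x ∈ₗ elements p
∈-elements here = here refl
∈-elements {p = inside ∷ p} (there x∈p) = there (∈-map⁺ suc (∈-elements x∈p))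
∈-elements {p = outside ∷ p} (there x∈p) = ∈-map⁺ suc (∈-elements x∈p)

length-cartesianProductWith : ∀ {A B C : Set} (f : A → B → C) xs ys →
  length (cartesianProductWith f xs ys) ≡ length xs ℕ.* length ys
length-cartesianProductWith f [] ys = refl
length-cartesianProductWith f (x ∷ xs) ys = begin
  length (map (f x) ys ++ cartesianProductWith f xs ys)           ≡⟨ length-++ (map (f x) ys) ⟩
  length (map (f x) ys) + length (cartesianProductWith f xs ys)   ≡⟨ cong₂ _+_ (length-map (f x) ys)
                                                                       (length-cartesianProductWith f xs ys) ⟩
  length ys + length xs ℕ.* length ys                             ∎
  where open ≡-Reasoning

count≤∣p∣*n : ∀ (P : Subset n → Bool) (g : Fin n → Fin n → Subset n) (p : Subset n) →
  (∀ S → T (P S) → ∃₂ λ v w → v ∈ p × S ≡ g v w) → count P ℕ.≤ ∣ p ∣ ℕ.* n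
count≤∣p∣*n {n} P g p covered = begin
  count P                                    ≤⟨ count≤length P images image-covers ⟩
  length images                              ≡⟨ length-cartesianProductWith g (elements p) (allFin n) ⟩
  length (elements p) ℕ.* length (allFin n)  ≡⟨ cong₂ ℕ._*_ (length-elements p) (length-tabulate (λ i → i)) ⟩
  ∣ p ∣ ℕ.* n                                ∎
  where
  open ℕ.≤-Reasoning
  images = cartesianProductWith g (elements p) (allFin n)
  image-covers : ∀ S → T (P S) → S ∈ₗ images
  image-covers S PS with v , w , v∈p , refl ← covered S PS =
    ∈-cartesianProductWith⁺ g (∈-elements v∈p) (∈-allFin w)

-- Natural numbers as rationals

⟦⟧≡mkℚ : ∀ k → ⟦ k ⟧ ≡ mkℚ (+ k) 0 (Coprime.sym (Coprime.1-coprimeTo k))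
⟦⟧≡mkℚ k = ℚ.normalize-coprime (Coprime.sym (Coprime.1-coprimeTo k))

⟦⟧-mono-≤ : ∀ {k l} → k ℕ.≤ l → ⟦ k ⟧ ≤ ⟦ l ⟧
⟦⟧-mono-≤ {k} {l} k≤l rewrite ⟦⟧≡mkℚ k | ⟦⟧≡mkℚ l =
  *≤* (subst₂ ℤ._≤_ (sym (ℤ.*-identityʳ (+ k))) (sym (ℤ.*-identityʳ (+ l))) (ℤ.+≤+ k≤l))

⟦⟧-homo-* : ∀ k l → ⟦ k ℕ.* l ⟧ ≡ ⟦ k ⟧ * ⟦ l ⟧
⟦⟧-homo-* k l rewrite ⟦⟧≡mkℚ k | ⟦⟧≡mkℚ l = ℚ./-cong (ℤ.pos-* k l) refl

⟦⟧-nonNeg : ∀ k → NonNegative ⟦ k ⟧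
⟦⟧-nonNeg k = ℚ.normalize-nonNeg k 1

0≤⟦⟧ : ∀ k → 0ℚ ≤ ⟦ k ⟧
0≤⟦⟧ k = ℚ.nonNegative⁻¹ ⟦ k ⟧ {{⟦⟧-nonNeg k}}

0≤* : ∀ {r s} → 0ℚ ≤ r → 0ℚ ≤ s → 0ℚ ≤ r * s
0≤* {r} {s} 0≤r 0≤s =
  ℚ.nonNegative⁻¹ (r * s) {{ℚ.nonNeg*nonNeg⇒nonNeg r {{ℚ.nonNegative 0≤r}} s {{ℚ.nonNegative 0≤s}}}}

-- Edges, links and poor vertices

edge-size : ∀ {H : ThreeGraph n} → Edge H E → ∣ E ∣ ≡ 3
edge-size {E = E} e = ≡ᵇ⇒≡ ∣ E ∣ 3 (proj₂ (to T-∧ e))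

edge-distinct : ∀ {H : ThreeGraph n} → Edge H (triple a b c) → a ≢ b × a ≢ c × b ≢ c
edge-distinct {H = H} = triple-distinct ∘ edge-size {H = H}

∈-link⁻ : ∀ {H : ThreeGraph n} {w} → a ∈ L H X (pair x w) → a ∈ X × Edge H (triple x w a)
∈-link⁻ {a = a} {x = x} {H} {w} a∈L with a∈X , e ← to T-∧ (∈-tabulate⁻ a∈L) =
  T-lookup⇒∈ a∈X , subst (Edge H) (∪-assoc ⁅ x ⁆ ⁅ w ⁆ ⁅ a ⁆) e

record PoorVertex (α : ℚ) (H : ThreeGraph n) (X : Subset n) (v : Fin n) : Set where
  field
    centre partner : Fin n
    centre∈X : centre ∈ X
    partner∉X : partner ∉ X
    poor∉X : v ∉ X
    edge : Edge H (triple centre partner v)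
    dense : α * ⟦ n ⟧ < ⟦ ∣ L H X (pair centre partner) ∣ ⟧

  link : Subset n
  link = L H X (pair centre partner)

rich-pair≤poorer-side : ∀ {H : ThreeGraph n} {x₁ y z w v} → triple x w v ≡ triple x₁ y z →
  x ∈ X → x₁ ∈ X → y ∉ X → z ∉ X → w ∉ X → v ∉ X →
  ∣ L H X (pair x v) ∣ ℕ.≤ ∣ L H X (pair x w) ∣ →
  ∣ L H X (pair x₁ y) ∣ ⊔ ∣ L H X (pair x₁ z) ∣ ℕ.≤ ∣ L H X (pair x w) ∣
rich-pair≤poorer-side {x = x} {X = X} {H = H} {x₁ = x₁} {y = y} {z = z} {w = w} {v = v}
  xwv≡ x∈X x₁∈X y∉X z∉X w∉X v∉X xv≤xw
  with refl ← inside-vertex-of-triple x₁∈X (subst (x₁ ∈_) (sym xwv≡) (∈-triple⁺ (inj₁ refl))) w∉X v∉X =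
  ⊔-lub (bounded (∈-triple⁺ (inj₂ (inj₁ refl))) y∉X) (bounded (∈-triple⁺ (inj₂ (inj₂ refl))) z∉X)
  where
  bounded-by-xw : ∀ {u} → u ≡ w ⊎ u ≡ v → ∣ L H X (pair x u) ∣ ℕ.≤ ∣ L H X (pair x w) ∣
  bounded-by-xw (inj₁ refl) = ≤-refl
  bounded-by-xw (inj₂ refl) = xv≤xw
  bounded : ∀ {u} → u ∈ triple x y z → u ∉ X → ∣ L H X (pair x u) ∣ ℕ.≤ ∣ L H X (pair x w) ∣
  bounded u∈ u∉X = bounded-by-xw (outside-vertex-of-triple x∈X (subst (_ ∈_) (sym xwv≡) u∈) u∉X)

rich⇒poorVertex : ∀ {α} {H : ThreeGraph n} {w v} → Rich α n H X (triple x w v) →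
  x ∈ X → w ∉ X → v ∉ X → ∣ L H X (pair x v) ∣ ℕ.≤ ∣ L H X (pair x w) ∣ → PoorVertex α H X v
rich⇒poorVertex {x = x} {H = H} {w} {v} (_ , _ , _ , xwv≡ , e , x₁∈X , y∈∁X , z∈∁X , rich)
  x∈X w∉X v∉X xv≤xw =
  record
    { centre = x ; partner = w ; centre∈X = x∈X ; partner∉X = w∉X ; poor∉X = v∉X ; edge = e
    ; dense = ℚ.<-≤-trans rich (⟦⟧-mono-≤ (rich-pair≤poorer-side {H = H} xwv≡ x∈X x₁∈X
                (x∈∁p⇒x∉p y∈∁X) (x∈∁p⇒x∉p z∈∁X) w∉X v∉X xv≤xw))
    }

chosen⇒poorVertex : ∀ {α} {H : ThreeGraph n} {v} → Rich α n H X E → IsPoor n H X E v → PoorVertex α H X v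
chosen⇒poorVertex rich (_ , _ , _ , refl , x∈X , w∈∁X , v∈∁X , xv≤xw) =
  rich⇒poorVertex rich x∈X (x∈∁p⇒x∉p w∈∁X) (x∈∁p⇒x∉p v∈∁X) xv≤xw

link∩edge≢2 : ∀ {α} {H : ThreeGraph n} {v} → T5-free H → (pv : PoorVertex α H X v) →
  Edge H E → v ∈ E → ∣ E ∩ PoorVertex.link pv ∣ ≢ 2
link∩edge≢2 {X = X} {E = E} {H = H} {v} T5-free-H pv e v∈E ∣E∩L∣≡2
  with a , b , a≢b , a∈ , b∈ ← two-elements (E ∩ PoorVertex.link pv) (≤-reflexive (sym ∣E∩L∣≡2)) =
  T5-free-H centre partner a b v
    x≢w x≢a x≢b x≢v w≢a w≢b w≢v a≢b (∈∧∉⇒≢ a∈X poor∉X) (∈∧∉⇒≢ b∈X poor∉X)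
    (xwa , xwb , edge , subst (Edge H) (sym abv≡E) e)
  where
  open PoorVertex pv
  a∈X×xwa = ∈-link⁻ {H = H} (p∩q⊆q E link a∈)
  b∈X×xwb = ∈-link⁻ {H = H} (p∩q⊆q E link b∈)
  a∈X = proj₁ a∈X×xwa
  xwa = proj₂ a∈X×xwa
  b∈X = proj₁ b∈X×xwb
  xwb = proj₂ b∈X×xwb
  x≢w = ∈∧∉⇒≢ centre∈X partner∉X
  x≢a = proj₁ (proj₂ (edge-distinct {H = H} xwa))
  w≢a = proj₂ (proj₂ (edge-distinct {H = H} xwa))
  x≢b = proj₁ (proj₂ (edge-distinct {H = H} xwb))
  w≢b = proj₂ (proj₂ (edge-distinct {H = H} xwb))
  x≢v = proj₁ (proj₂ (edge-distinct {H = H} edge))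
  w≢v = proj₂ (proj₂ (edge-distinct {H = H} edge))
  abv≡E = triple-unique (edge-size {H = H} e) a≢b (∈∧∉⇒≢ a∈X poor∉X) (∈∧∉⇒≢ b∈X poor∉X)
            (p∩q⊆p E link a∈) (p∩q⊆p E link b∈) v∈E

avoiding-vertices-few : ∀ {μ} {H : ThreeGraph n} → 0ℚ < μ → LowerDense μ n H X →
  (Y' : Subset n) (Xs : Fin n → Subset n) → Y' ⊆ ∁ X →
  (∀ y → y ∈ Y' → Xs y ⊆ X × ⟦ 200 ⟧ * μ * ⟦ n ⟧ < ⟦ ∣ Xs y ∣ ⟧) →
  (∀ y E → y ∈ Y' → Edge H E → y ∈ E → ∣ E ∩ Xs y ∣ ≢ 2) →
  ⟦ ∣ Y' ∣ ⟧ < ⟦ 2 ⟧ * μ * ⟦ n ⟧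
avoiding-vertices-few {n} {μ = μ} {H} μ>0 (_ , _ , _ , iv , _) Y' Xs Y'⊆∁X large avoid =
  ℚ.≰⇒> λ 2μn≤∣Y'∣ → ℚ.<-irrefl refl
    (ℚ.<-≤-trans (ℚ.<-≤-trans (iv Y' Xs Y'⊆∁X 2μn≤∣Y'∣ large) counted≤0) 0≤bound)
  where
  0≤μ = ℚ.<⇒≤ μ>0
  0≤bound : 0ℚ ≤ ⟦ 10000 ⟧ * (μ * μ * μ) * ⟦ n ^ 3 ⟧
  0≤bound = 0≤* {⟦ 10000 ⟧ * (μ * μ * μ)}
              (0≤* {⟦ 10000 ⟧} (0≤⟦⟧ 10000) (0≤* {μ * μ} (0≤* 0≤μ 0≤μ) 0≤μ)) (0≤⟦⟧ (n ^ 3))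
  counted : Subset n → Bool
  counted E = isEdge H E ∧ any (λ y → lookup Y' y ∧ lookup E y ∧ (∣ E ∩ Xs y ∣ ℕ.≡ᵇ 2)) (allFin n)
  never-counted : ∀ E → T (counted E) → E ∈ₗ []
  never-counted E t with e , t′ ← to T-∧ t
    with y , t″ ← satisfied (any⁻ _ (allFin n) t′)
    with y∈Y' , t‴ ← to T-∧ t″
    with y∈E , ∣E∩Xs∣≡ᵇ2 ← to T-∧ t‴ =
    ⊥-elim (avoid y E (T-lookup⇒∈ y∈Y') e (T-lookup⇒∈ y∈E) (≡ᵇ⇒≡ _ 2 ∣E∩Xs∣≡ᵇ2))
  counted≤0 : ⟦ count counted ⟧ ≤ 0ℚ
  counted≤0 = ⟦⟧-mono-≤ (count≤length counted [] never-counted)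

few-poor-vertices : ∀ {μ α} {H : ThreeGraph n} → 0ℚ < μ → ⟦ 200 ⟧ * μ ≤ α → T5-free H →
  LowerDense μ n H X → (Y' : Subset n) → (∀ v → v ∈ Y' → PoorVertex α H X v) →
  ⟦ ∣ Y' ∣ ⟧ < ⟦ 2 ⟧ * μ * ⟦ n ⟧
few-poor-vertices {n} {X} {μ} {α} {H} μ>0 200μ≤α T5-free-H lowerDense Y' poor =
  avoiding-vertices-few μ>0 lowerDense Y' links (λ v∈Y' → x∉p⇒x∈∁p (PoorVertex.poor∉X (poor _ v∈Y')))
    (λ y → large-at (y ∈? Y')) (λ y → avoid-at (y ∈? Y'))
  where
  linkAt : ∀ {v} → Dec (v ∈ Y') → Subset n
  linkAt (yes v∈Y') = PoorVertex.link (poor _ v∈Y')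
  linkAt (no _) = X
  links : Fin n → Subset n
  links v = linkAt (v ∈? Y')
  large-at : ∀ {y} (d : Dec (y ∈ Y')) → y ∈ Y' → linkAt d ⊆ X × ⟦ 200 ⟧ * μ * ⟦ n ⟧ < ⟦ ∣ linkAt d ∣ ⟧
  large-at (no y∉Y') y∈Y' = contradiction y∈Y' y∉Y'
  large-at (yes y∈Y') _ =
    proj₁ ∘ ∈-link⁻ {H = H} ,
    ℚ.≤-<-trans {j = α * ⟦ n ⟧} (ℚ.*-monoʳ-≤-nonNeg ⟦ n ⟧ {{⟦⟧-nonNeg n}} 200μ≤α)
                                (PoorVertex.dense (poor _ y∈Y'))
  avoid-at : ∀ {y} (d : Dec (y ∈ Y')) E → y ∈ Y' → Edge H E → y ∈ E → ∣ E ∩ linkAt d ∣ ≢ 2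
  avoid-at (no y∉Y') _ y∈Y' = contradiction y∈Y' y∉Y'
  avoid-at (yes y∈Y') _ _ = link∩edge≢2 T5-free-H (poor _ y∈Y')

module RichEdgesAt {α : ℚ} {H : ThreeGraph n} {X : Subset n} {x : Fin n} (x∈X : x ∈ X)
  (F : Subset n → Bool) (rich-at : ∀ E → T (F E) → Rich α n H X E × x ∈ E) where

  PoorerSide : Fin n → Fin n → Set
  PoorerSide v w = T (F (triple x w v)) × v ∉ X × w ∉ X × ∣ L H X (pair x v) ∣ ℕ.≤ ∣ L H X (pair x w) ∣

  poorerSide? : ∀ v w → Dec (PoorerSide v w)
  poorerSide? v w = T? (F (triple x w v)) ×-dec ¬? (v ∈? X) ×-dec ¬? (w ∈? X)
                      ×-dec (∣ L H X (pair x v) ∣ ℕ.≤? ∣ L H X (pair x w) ∣)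

  poorerVertices : Subset n
  poorerVertices = subsetOf (λ v → any? (poorerSide? v))

  poorer⇒poorVertex : ∀ v → v ∈ poorerVertices → PoorVertex α H X v
  poorer⇒poorVertex v v∈ with w , Fxwv , v∉X , w∉X , xv≤xw ← ∈-subsetOf⁻ v∈ =
    rich⇒poorVertex (proj₁ (rich-at _ Fxwv)) x∈X w∉X v∉X xv≤xw

  poorer-side : ∀ {y z} → T (F (triple x y z)) → y ∉ X → z ∉ X →
    ∃₂ λ v w → v ∈ poorerVertices × triple x y z ≡ triple x w v
  poorer-side {y} {z} Fxyz y∉X z∉X with ∣ L H X (pair x z) ∣ ℕ.≤? ∣ L H X (pair x y) ∣
  ... | yes xz≤xy = z , y , ∈-subsetOf⁺ (y , Fxyz , z∉X , y∉X , xz≤xy) , refl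
  ... | no xz≰xy =
    y , z , ∈-subsetOf⁺ (z , subst (T ∘ F) xyz≡xzy Fxyz , y∉X , z∉X , <⇒≤ (≰⇒> xz≰xy)) , xyz≡xzy
    where
    xyz≡xzy : triple x y z ≡ triple x z y
    xyz≡xzy = cong (⁅ x ⁆ ∪_) (∪-comm ⁅ y ⁆ ⁅ z ⁆)

  rich-at⇒poorer : ∀ E → T (F E) → ∃₂ λ v w → v ∈ poorerVertices × E ≡ triple x w v
  rich-at⇒poorer E FE = from-rich (rich-at E FE)
    where
    from-rich : Rich α n H X E × x ∈ E → ∃₂ λ v w → v ∈ poorerVertices × E ≡ triple x w v
    from-rich ((_ , y , z , E≡x₁yz , _ , _ , y∈∁X , z∈∁X , _) , x∈E) =
      let v , w , v∈ , xyz≡xwv = poorer-side (subst (T ∘ F) E≡xyz FE) y∉X z∉X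
      in v , w , v∈ , trans E≡xyz xyz≡xwv
      where
      y∉X = x∈∁p⇒x∉p y∈∁X
      z∉X = x∈∁p⇒x∉p z∈∁X
      E≡xyz : E ≡ triple x y z
      E≡xyz = trans E≡x₁yz (cong (λ u → triple u y z)
                (sym (inside-vertex-of-triple x∈X (subst (x ∈_) E≡x₁yz x∈E) y∉X z∉X)))

  count≤∣poorer∣*n : count F ℕ.≤ ∣ poorerVertices ∣ ℕ.* n
  count≤∣poorer∣*n = count≤∣p∣*n F (λ v w → triple x w v) poorerVertices rich-at⇒poorer

chosen-poor-vertices-few : ∀ {μ α} {H : ThreeGraph n} {c} → 0ℚ < μ → ⟦ 200 ⟧ * μ ≤ α → T5-free H →
  LowerDense μ n H X → PoorChoice α n H X c →
  (P : Subset n) → (∀ v → v ∈ P → ∃ λ E → Rich α n H X E × c E ≡ v) → ⟦ ∣ P ∣ ⟧ ≤ ⟦ 2 ⟧ * μ * ⟦ n ⟧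
chosen-poor-vertices-few {X = X} {α = α} {H} μ>0 200μ≤α T5-free-H lowerDense choice P chosen =
  ℚ.<⇒≤ (few-poor-vertices μ>0 200μ≤α T5-free-H lowerDense P poor)
  where
  poor : ∀ v → v ∈ P → PoorVertex α H X v
  poor v v∈P = let E , rich , cE≡v = chosen v v∈P in
    subst (PoorVertex α H X) cE≡v (chosen⇒poorVertex rich (choice E rich))

rich-edges-at-few : ∀ {μ α} {H : ThreeGraph n} → 0ℚ < μ → ⟦ 200 ⟧ * μ ≤ α → T5-free H →
  LowerDense μ n H X → x ∈ X → (F : Subset n → Bool) →
  (∀ E → T (F E) → Rich α n H X E × x ∈ E) → ⟦ count F ⟧ ≤ ⟦ 2 ⟧ * μ * ⟦ n ^ 2 ⟧
rich-edges-at-few {n} {μ = μ} {α} {H} μ>0 200μ≤α T5-free-H lowerDense x∈X F rich-at = begin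
  ⟦ count F ⟧                    ≤⟨ ⟦⟧-mono-≤ count≤∣poorer∣*n ⟩
  ⟦ ∣ poorerVertices ∣ ℕ.* n ⟧   ≡⟨ ⟦⟧-homo-* ∣ poorerVertices ∣ n ⟩
  ⟦ ∣ poorerVertices ∣ ⟧ * ⟦ n ⟧ ≤⟨ ℚ.*-monoʳ-≤-nonNeg ⟦ n ⟧ {{⟦⟧-nonNeg n}} (ℚ.<⇒≤
                                      (few-poor-vertices μ>0 200μ≤α T5-free-H lowerDense
                                         poorerVertices poorer⇒poorVertex)) ⟩
  ⟦ 2 ⟧ * μ * ⟦ n ⟧ * ⟦ n ⟧      ≡⟨ ℚ.*-assoc (⟦ 2 ⟧ * μ) ⟦ n ⟧ ⟦ n ⟧ ⟩
  ⟦ 2 ⟧ * μ * (⟦ n ⟧ * ⟦ n ⟧)    ≡⟨ cong (⟦ 2 ⟧ * μ *_) (sym n²≡n*n) ⟩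
  ⟦ 2 ⟧ * μ * ⟦ n ^ 2 ⟧          ∎
  where
  open ℚ.≤-Reasoning
  open RichEdgesAt {α = α} {H = H} x∈X F rich-at
  n²≡n*n : ⟦ n ^ 2 ⟧ ≡ ⟦ n ⟧ * ⟦ n ⟧
  n²≡n*n = trans (cong (λ k → ⟦ n ℕ.* k ⟧) (ℕ.*-identityʳ n)) (⟦⟧-homo-* n n)

lemma14 : (μ η α : ℚ) → 0ℚ < μ → 0ℚ < η → η < 1ℚ → EntropyCond μ η →
    (n : ℕ) (H : ThreeGraph n) → InForbμ n η μ H →
    (X : Subset n) → Optimal H X → ⟦ 200 ⟧ * μ ≤ α →
    ((c : Subset n → Fin n) → PoorChoice α n H X c →
       (P : Subset n) → (∀ v → v ∈ P → ∃ λ E → Rich α n H X E × c E ≡ v) →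
       ⟦ ∣ P ∣ ⟧ ≤ ⟦ 2 ⟧ * μ * ⟦ n ⟧)
    ×
    ((x : Fin n) → x ∈ X → (F : Subset n → Bool) →
       (∀ E → T (F E) → Rich α n H X E × x ∈ E) →
       ⟦ count F ⟧ ≤ ⟦ 2 ⟧ * μ * ⟦ n ^ 2 ⟧)
-- Only T₅-freeness and condition (iv) of lower density are needed.
lemma14 μ η α μ>0 _ _ _ n H ((T5-free-H , _) , lowerDense) X optimal 200μ≤α =
  (λ c → chosen-poor-vertices-few {c = c} μ>0 200μ≤α T5-free-H (lowerDense X optimal)) ,
  (λ x x∈X → rich-edges-at-few μ>0 200μ≤α T5-free-H (lowerDense X optimal) x∈X)
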